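{- Let $A$ and $B$ be distinct atomic terms. The formula $A\rightarrow \ominus B^c \Rightarrow B\rightarrow \ominus A^c$ is not valid, i.e. there is an extensional model $M$ with $M\Vdash A\rightarrow\ominus B^c$ and $M\not\Vdash B\rightarrow\ominus A^c$.
   Context: Terms over a set $T$ of atomic terms: atomic terms, and $A^c$, $\square A$, $\sqcup A$ for terms $A$; $\ominus A := (\sqcup A)^c$. An extensional model is $M=(I,V)$ with $I$ a nonempty set and $V$ a nonempty set of maps $v:T\to\mathcal P(I)$. For $v\in V$: $E_v(t)=v(t)$; $E_v(A^c)=I\setminus E_v(A)$; $E_v(\square A)=\bigcap_{w\in V}E_w(A)$; $E_v(\sqcup A)=\{a\in I: (\forall w\in V.\ a\in E_w(A)) \text{ or } (\forall w\in V.\ a\notin E_w(A))\}$. Thus $E_v(\ominus A)=\{a: \exists u\in V.\ a\in E_u(A)\text{ and }\exists w\in V.\ a\notin E_w(A)\}$. $M\Vdash A\rightarrow B$ iff $E_v(A)\subseteq E_v(B)$ for all $v\in V$. $M\Vdash \phi\Rightarrow\psi$ iff $M\not\Vdash\phi$ or $M\Vdash\psi$; a formula is valid if it is satisfied in every extensional model. -}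

module Defs where

open import Data.Product using (Σ; _×_; _,_)
open import Data.Sum using (_⊎_)
open import Relation.Nullary using (¬_)

data Term (T : Set) : Set where
  atom : T → Term T
  _ᶜ   : Term T → Term T
  □_   : Term T → Term T
  ⊔_   : Term T → Term T

⊖_ : {T : Set} → Term T → Term T
⊖ A = (⊔ A) ᶜ

-- Subsets of I are predicates I → Set.
-- The nonempty set V of maps T → P(I) is given as a nonempty index type W
-- together with the family val : W → (T → I → Set) (V = its image).
record Model (T : Set) : Set₁ where
  field
    I      : Set
    i₀     : I
    W      : Set
    w₀     : W
    val    : W → T → I → Set

open Model public

E : {T : Set} (M : Model T) → W M → Term T → I M → Set
E M v (atom t) a = val M v t a
E M v (A ᶜ)    a = ¬ E M v A a
E M v (□ A)    a = ∀ w → E M w A a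
E M v (⊔ A)    a = (∀ w → E M w A a) ⊎ (∀ w → ¬ E M w A a)

_⊩_⇒_ : {T : Set} → Model T → Term T → Term T → Set
M ⊩ A ⇒ B = ∀ v a → E M v A a → E M v B a

module Submission where

open import Defs
open import Data.Product using (Σ; _×_; _,_)
open import Data.Sum using (inj₁; inj₂)
open import Data.Unit using (⊤; tt)
open import Relation.Nullary using (¬_)
open import Relation.Binary.PropositionalEquality using (_≡_; _≢_; refl; subst; ≢-sym)

-- Countermodel: one world and one point, where every atom other than A holds.
-- Then A → ⊖ Bᶜ holds vacuously, B holds, but ⊖ Aᶜ needs two worlds that
-- disagree on Aᶜ, so it is empty.

⊖-empty-in-single-world : {T : Set} (M : Model T) → (∀ (w w′ : W M) → w ≡ w′) →
  ∀ v C a → ¬ E M v (⊖ C) a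
⊖-empty-in-single-world M single v C a ⊖C = ⊖C (inj₂ ¬C)
  where
  C-everywhere : E M v C a → ∀ w → E M w C a
  C-everywhere Cv w = subst (λ u → E M u C a) (single v w) Cv

  ¬C : ∀ w → ¬ E M w C a
  ¬C w Cw = ⊖C (inj₁ (C-everywhere (subst (λ u → E M u C a) (single w v) Cw)))

⊩-from-empty : {T : Set} (M : Model T) (A B : Term T) →
  (∀ v a → ¬ E M v A a) → M ⊩ A ⇒ B
⊩-from-empty M A B emptyA v a Av with emptyA v a Av
... | ()

allExcept : {T : Set} → T → Model T
allExcept A = record { I = ⊤ ; i₀ = tt ; W = ⊤ ; w₀ = tt ; val = λ _ t _ → t ≢ A }

lemma2p9 : (T : Set) (A B : T) → A ≢ B →
    Σ (Model T) (λ M → (M ⊩ atom A ⇒ (⊖ (atom B ᶜ))) × ¬ (M ⊩ atom B ⇒ (⊖ (atom A ᶜ))))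
lemma2p9 T A B A≢B = M , A⇒⊖Bᶜ , B⇏⊖Aᶜ
  where
  M : Model T
  M = allExcept A

  A⇒⊖Bᶜ : M ⊩ atom A ⇒ (⊖ (atom B ᶜ))
  A⇒⊖Bᶜ = ⊩-from-empty M (atom A) (⊖ (atom B ᶜ)) (λ _ _ A≢A → A≢A refl)

  B⇏⊖Aᶜ : ¬ (M ⊩ atom B ⇒ (⊖ (atom A ᶜ)))
  B⇏⊖Aᶜ B⇒⊖Aᶜ = ⊖-empty-in-single-world M (λ _ _ → refl) tt (atom A ᶜ) tt
                   (B⇒⊖Aᶜ tt tt (≢-sym A≢B))
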